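{- Let $n\ge 1$ and let $r_\star$ be an integer maximising $|Q^{(r)}(P_n)|$ over $0\le r\le n$. Then either \[ r_\star = \left\lceil \tfrac{1}{10}\left(5n+2-\sqrt{5n^2+20n+24}\right)\right\rceil \] or \[ r_\star = \tfrac{1}{10}\left(5n+2-\sqrt{5n^2+20n+24}\right)+1. \]
   Context: $P_n$ is the path on vertex set $[n]=\{1,\dots,n\}$ with edges $\{i,i+1\}$, $1\le i\le n-1$. $Q(P_n)$ is the collection of subsets of $[n]$ containing no two consecutive integers, and $Q^{(r)}(P_n)$ is the set of its members of size $r$. -}

module Defs where

open import Data.Nat as ℕ using (ℕ; zero; suc)
open import Data.Integer as ℤ using (ℤ; +_; _+_; _-_; _*_; _<_; _≤_)
open import Data.Fin using (Fin; toℕ)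
open import Data.Fin.Properties using (all?)
open import Data.Fin.Subset using (Subset; _∈_; ∣_∣)
open import Data.Fin.Subset.Properties using (_∈?_)
open import Data.Vec using (_∷_; [])
open import Data.List using (List; []; _∷_; map; _++_; filter; length)
open import Data.Bool using (true; false)
open import Data.Product using (_×_)
open import Data.Sum using (_⊎_)
open import Relation.Nullary using (¬_; Dec)
open import Relation.Nullary.Decidable using (_→-dec_; ¬?; _×-dec_)
open import Relation.Binary.PropositionalEquality using (_≡_)

-- Vertex i+1 of P_n is represented by (i : Fin n); subsets of [n] are Subset n.
-- All 2^n subsets of Fin n.
allSubsets : (n : ℕ) → List (Subset n)
allSubsets zero = [] ∷ []
allSubsets (suc n) = map (true ∷_) (allSubsets n) ++ map (false ∷_) (allSubsets n)

NoTwoConsecutive : {n : ℕ} → Subset n → Set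
NoTwoConsecutive {n} p =
  (i j : Fin n) → toℕ j ≡ suc (toℕ i) → ¬ (i ∈ p × j ∈ p)

noTwoConsecutive? : {n : ℕ} (p : Subset n) → Dec (NoTwoConsecutive p)
noTwoConsecutive? p = all? λ i → all? λ j →
  (toℕ j ℕ.≟ suc (toℕ i)) →-dec ¬? ((i ∈? p) ×-dec (j ∈? p))

InQr : (n r : ℕ) → Subset n → Set
InQr n r p = NoTwoConsecutive p × ∣ p ∣ ≡ r

inQr? : (n r : ℕ) (p : Subset n) → Dec (InQr n r p)
inQr? n r p = noTwoConsecutive? p ×-dec (∣ p ∣ ℕ.≟ r)

cardQr : (n r : ℕ) → ℕ
cardQr n r = length (filter (inQr? n r) (allSubsets n))

IsMaximiser : (n r : ℕ) → Set
IsMaximiser n r = r ℕ.≤ n × ((s : ℕ) → s ℕ.≤ n → cardQr n s ℕ.≤ cardQr n r)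

-- Exact integer comparisons with √D (D ≥ 0), avoiding real numbers:
-- a ≤ √D
_≤√_ : ℤ → ℤ → Set
a ≤√ D = a ≤ + 0 ⊎ a * a ≤ D

√_<_ : ℤ → ℤ → Set
√ D < b = + 0 < b × D < b * b

√_≡_ : ℤ → ℤ → Set
√ D ≡ b = + 0 ≤ b × b * b ≡ D

-- D = 5n² + 20n + 24,  x = (5n + 2 - √D)/10
Dn : ℕ → ℤ
Dn n = + 5 * + n * + n + + 20 * + n + + 24

-- r = ⌈x⌉  ⟺  r - 1 < x ≤ r  ⟺  5n + 2 - 10r ≤ √D < 5n + 12 - 10r
IsCeilX : (n r : ℕ) → Set
IsCeilX n r = ((+ 5 * + n + + 2 - + 10 * + r) ≤√ Dn n)
            × (√ Dn n < (+ 5 * + n + + 12 - + 10 * + r))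

-- r = x + 1  ⟺  10r - 10 = 5n + 2 - √D  ⟺  √D = 5n + 12 - 10r
IsXPlusOne : (n r : ℕ) → Set
IsXPlusOne n r = √ Dn n ≡ (+ 5 * + n + + 12 - + 10 * + r)

-- Splitting off the first one or two vertices of the path gives Pascal's recurrence, so
-- |Q^(r)(P_n)| = C(m+1, r) for n = r + m.  Maximality of r against r + 1 and r - 1, read through
-- the ratios of neighbouring binomial coefficients, yields k(k+1) ≤ (r+1)(r+k+1) for n = 2r + k
-- and r(r+j) ≤ (j+1)j for n = 2r + j - 2; multiplied by 20 these are (5n+2-10r)² ≤ D and
-- D ≤ (5n+12-10r)², the two sides of the ceiling condition, and equality in the second one is
-- r = x + 1.  Comparing with r = 0 shows r ≤ m + 1; when r > m the left end 5n+2-10r is negative.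
module Submission where

open import Defs
open import Level using (Level)
open import Data.Bool using (true; false)
open import Data.Nat
  using (ℕ; zero; suc; _+_; _*_; _≤_; _<_; z≤n; s≤s; s≤s⁻¹; _≤?_; NonZero; >-nonZero)
open import Data.Nat.Properties
open import Data.Nat.Combinatorics using (_C_; nC1≡n; k>n⇒nCk≡0; nCk+nC[k+1]≡[n+1]C[k+1])
open import Data.Nat.Tactic.RingSolver using (solve-∀)
open import Data.Integer as ℤ using (ℤ; +_; +≤+; +<+)
import Data.Integer.Properties as ℤₚ
import Data.Integer.Tactic.RingSolver as ℤ-Solver
open import Data.Fin using (zero; suc)
open import Data.Fin.Subset using (Subset; inside; outside)
open import Data.Fin.Subset.Properties using (∣p∣≤n)
open import Data.Vec using (_∷_; here; there)
open import Data.List using (List; []; _∷_; _++_; map; filter; length)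
open import Data.List.Properties using (filter-++; filter-none; filter-≐; length-++)
open import Data.List.Relation.Unary.All using (universal)
open import Data.Sum using (_⊎_; inj₁; inj₂)
open import Data.Product using (_×_; _,_)
open import Function using (_∘_)
open import Relation.Nullary using (¬_; yes; no; does; contradiction)
open import Relation.Unary using (Pred; Decidable; _≐_)
open import Relation.Binary.PropositionalEquality

private variable
  ℓ : Level
  A B : Set
  n r : ℕ

length-filter-map : ∀ {P : Pred B ℓ} (P? : Decidable P) (f : A → B) (xs : List A) →
                    length (filter P? (map f xs)) ≡ length (filter (P? ∘ f) xs)
length-filter-map P? f [] = refl
length-filter-map P? f (x ∷ xs) with does (P? (f x))
... | true  = cong suc (length-filter-map P? f xs)
... | false = length-filter-map P? f xs

length-filter-++ : ∀ {P : Pred A ℓ} (P? : Decidable P) (xs ys : List A) →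
                   length (filter P? (xs ++ ys)) ≡ length (filter P? xs) + length (filter P? ys)
length-filter-++ P? xs ys = trans (cong length (filter-++ P? xs ys)) (length-++ (filter P? xs))

noTwoConsecutive-tail : ∀ {x} {p : Subset n} → NoTwoConsecutive (x ∷ p) → NoTwoConsecutive p
noTwoConsecutive-tail ntc i j j≡1+i (i∈p , j∈p) =
  ntc (suc i) (suc j) (cong suc j≡1+i) (there i∈p , there j∈p)

noTwoConsecutive-outside : {p : Subset n} → NoTwoConsecutive p → NoTwoConsecutive (outside ∷ p)
noTwoConsecutive-outside ntc zero    j       _     (() , _)
noTwoConsecutive-outside ntc (suc i) zero    ()    _
noTwoConsecutive-outside ntc (suc i) (suc j) j≡1+i (there i∈p , there j∈p) =
  ntc i j (suc-injective j≡1+i) (i∈p , j∈p)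

noTwoConsecutive-inside-outside : {p : Subset n} → NoTwoConsecutive p →
                                  NoTwoConsecutive (inside ∷ outside ∷ p)
noTwoConsecutive-inside-outside ntc zero    (suc zero) _     (_ , there ())
noTwoConsecutive-inside-outside ntc (suc i) (suc j)    j≡1+i (there i∈p , there j∈p) =
  noTwoConsecutive-outside ntc i j (suc-injective j≡1+i) (i∈p , j∈p)
noTwoConsecutive-inside-outside ntc zero    zero          ()
noTwoConsecutive-inside-outside ntc zero    (suc (suc j)) ()
noTwoConsecutive-inside-outside ntc (suc i) zero          ()

¬noTwoConsecutive-inside-inside : {p : Subset n} → ¬ NoTwoConsecutive (inside ∷ inside ∷ p)
¬noTwoConsecutive-inside-inside ntc = ntc zero (suc zero) refl (here , there here)

InQr-outside : ∀ n r → (InQr (suc n) r ∘ (outside ∷_)) ≐ InQr n r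
InQr-outside n r = (λ (ntc , size) → noTwoConsecutive-tail ntc , size)
                 , (λ (ntc , size) → noTwoConsecutive-outside ntc , size)

InQr-inside-outside : ∀ n r →
                      (InQr (suc (suc n)) (suc r) ∘ λ p → inside ∷ outside ∷ p) ≐ InQr n r
InQr-inside-outside n r =
    (λ (ntc , size) → noTwoConsecutive-tail (noTwoConsecutive-tail ntc) , suc-injective size)
  , (λ (ntc , size) → noTwoConsecutive-inside-outside ntc , cong suc size)

cardQr-suc : ∀ n r →
  cardQr (suc n) r ≡ length (filter (inQr? (suc n) r ∘ (inside ∷_)) (allSubsets n)) + cardQr n r
cardQr-suc n r = begin
  cardQr (suc n) r
    ≡⟨ length-filter-++ P? (map (inside ∷_) S) (map (outside ∷_) S) ⟩
  length (filter P? (map (inside ∷_) S)) + length (filter P? (map (outside ∷_) S))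
    ≡⟨ cong₂ _+_ (length-filter-map P? (inside ∷_) S) (length-filter-map P? (outside ∷_) S) ⟩
  length (filter (P? ∘ (inside ∷_)) S) + length (filter (P? ∘ (outside ∷_)) S)
    ≡⟨ cong (λ k → length (filter (P? ∘ (inside ∷_)) S) + length k)
            (filter-≐ _ (inQr? n r) (InQr-outside n r) S) ⟩
  length (filter (P? ∘ (inside ∷_)) S) + cardQr n r ∎
  where
  open ≡-Reasoning
  P? = inQr? (suc n) r
  S  = allSubsets n

cardQr-zero : ∀ n → cardQr n 0 ≡ 1
cardQr-zero zero    = refl
cardQr-zero (suc n) = begin
  cardQr (suc n) 0
    ≡⟨ cardQr-suc n 0 ⟩
  length (filter (inQr? (suc n) 0 ∘ (inside ∷_)) (allSubsets n)) + cardQr n 0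
    ≡⟨ cong₂ _+_ (cong length (filter-none _ (universal (λ _ (_ , size) → 0≢1+n (sym size)) (allSubsets n))))
                 (cardQr-zero n) ⟩
  1 ∎
  where open ≡-Reasoning

n<r⇒cardQr≡0 : n < r → cardQr n r ≡ 0
n<r⇒cardQr≡0 {n} {r} n<r = cong length (filter-none (inQr? n r) (universal ¬InQr (allSubsets n)))
  where
  ¬InQr : ∀ p → ¬ InQr n r p
  ¬InQr p (_ , size) = <⇒≱ n<r (subst (_≤ n) size (∣p∣≤n p))

cardQr-suc-suc : ∀ n r → cardQr (suc (suc n)) (suc r) ≡ cardQr (suc n) (suc r) + cardQr n r
cardQr-suc-suc n r = begin
  cardQr (suc (suc n)) (suc r)
    ≡⟨ cardQr-suc (suc n) (suc r) ⟩
  length (filter P? (map (inside ∷_) S ++ map (outside ∷_) S)) + cardQr (suc n) (suc r)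
    ≡⟨ cong (_+ N) (length-filter-++ P? (map (inside ∷_) S) (map (outside ∷_) S)) ⟩
  length (filter P? (map (inside ∷_) S)) + length (filter P? (map (outside ∷_) S)) + N
    ≡⟨ cong₂ (λ a b → a + b + N)
             (length-filter-map P? (inside ∷_) S) (length-filter-map P? (outside ∷_) S) ⟩
  length (filter (P? ∘ (inside ∷_)) S) + length (filter (P? ∘ (outside ∷_)) S) + N
    ≡⟨ cong₂ (λ a b → length a + length b + N)
             (filter-none _ (universal (λ _ (ntc , _) → ¬noTwoConsecutive-inside-inside ntc) S))
             (filter-≐ _ (inQr? n r) (InQr-inside-outside n r) S) ⟩
  cardQr n r + N      ≡⟨ +-comm (cardQr n r) N ⟩
  N + cardQr n r ∎
  where
  open ≡-Reasoning
  P? = inQr? (suc (suc n)) (suc r) ∘ (inside ∷_)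
  S  = allSubsets n
  N  = cardQr (suc n) (suc r)

cardQr≡[1+m]Cr : ∀ r m → r + m ≡ n → cardQr n r ≡ suc m C r
cardQr≡[1+m]Cr zero m refl = cardQr-zero m
cardQr≡[1+m]Cr (suc zero) zero refl = refl
cardQr≡[1+m]Cr (suc (suc r)) zero refl rewrite +-identityʳ r = begin
  cardQr (suc (suc r)) (suc (suc r))
    ≡⟨ cardQr-suc-suc r (suc r) ⟩
  cardQr (suc r) (suc (suc r)) + cardQr r (suc r)
    ≡⟨ cong₂ _+_ (n<r⇒cardQr≡0 (n<1+n (suc r))) (n<r⇒cardQr≡0 (n<1+n r)) ⟩
  0 ∎
  where open ≡-Reasoning
cardQr≡[1+m]Cr (suc r) (suc m) refl = begin
  cardQr (suc r + suc m) (suc r)                ≡⟨ cong (λ k → cardQr (suc k) (suc r)) (+-suc r m) ⟩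
  cardQr (suc (suc (r + m))) (suc r)             ≡⟨ cardQr-suc-suc (r + m) r ⟩
  cardQr (suc r + m) (suc r) + cardQr (r + m) r
    ≡⟨ cong₂ _+_ (cardQr≡[1+m]Cr (suc r) m refl) (cardQr≡[1+m]Cr r m refl) ⟩
  suc m C suc r + suc m C r                      ≡⟨ +-comm (suc m C suc r) _ ⟩
  suc m C r + suc m C suc r                      ≡⟨ nCk+nC[k+1]≡[n+1]C[k+1] (suc m) r ⟩
  suc (suc m) C suc r ∎
  where open ≡-Reasoning

cardQr[1+r]≡mC[1+r] : ∀ r m → r + m ≡ n → cardQr n (suc r) ≡ m C suc r
cardQr[1+r]≡mC[1+r] r zero    r+0≡n =
  n<r⇒cardQr≡0 (s≤s (≤-reflexive (trans (sym r+0≡n) (+-identityʳ r))))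
cardQr[1+r]≡mC[1+r] r (suc m) r+m≡n = cardQr≡[1+m]Cr (suc r) m (trans (sym (+-suc r m)) r+m≡n)

[k+1]*[n+1]C[k+1]≡[n+1]*nCk : ∀ n k → suc k * (suc n C suc k) ≡ suc n * (n C k)
[k+1]*[n+1]C[k+1]≡[n+1]*nCk zero    zero    = refl
[k+1]*[n+1]C[k+1]≡[n+1]*nCk zero    (suc k) = *-zeroʳ (suc (suc k))
[k+1]*[n+1]C[k+1]≡[n+1]*nCk (suc n) zero    =
  trans (+-identityʳ _) (trans (nC1≡n (suc (suc n))) (sym (*-identityʳ _)))
[k+1]*[n+1]C[k+1]≡[n+1]*nCk (suc n) (suc k) = begin
  suc (suc k) * (suc (suc n) C suc (suc k))
    ≡⟨ cong (suc (suc k) *_) (sym (nCk+nC[k+1]≡[n+1]C[k+1] (suc n) (suc k))) ⟩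
  suc (suc k) * (suc n C suc k + suc n C suc (suc k))
    ≡⟨ expand (suc n C suc k) (suc n C suc (suc k)) k ⟩
  suc k * (suc n C suc k) + suc n C suc k + suc (suc k) * (suc n C suc (suc k))
    ≡⟨ cong₂ (λ a b → a + suc n C suc k + b)
             ([k+1]*[n+1]C[k+1]≡[n+1]*nCk n k) ([k+1]*[n+1]C[k+1]≡[n+1]*nCk n (suc k)) ⟩
  suc n * (n C k) + suc n C suc k + suc n * (n C suc k)
    ≡⟨ collect (n C k) (n C suc k) (suc n C suc k) n ⟩
  suc n * (n C k + n C suc k) + suc n C suc k
    ≡⟨ cong (λ c → suc n * c + suc n C suc k) (nCk+nC[k+1]≡[n+1]C[k+1] n k) ⟩
  suc n * (suc n C suc k) + suc n C suc k
    ≡⟨ +-comm (suc n * (suc n C suc k)) _ ⟩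
  suc (suc n) * (suc n C suc k) ∎
  where
  open ≡-Reasoning
  expand : ∀ x y k → suc (suc k) * (x + y) ≡ suc k * x + x + suc (suc k) * y
  expand = solve-∀
  collect : ∀ x y z n → suc n * x + z + suc n * y ≡ suc n * (x + y) + z
  collect = solve-∀

0<[a+j]Ca : ∀ a j → 0 < (a + j) C a
0<[a+j]Ca zero    j = s≤s z≤n
0<[a+j]Ca (suc a) j = ≤-trans (0<[a+j]Ca a j)
  (≤-trans (m≤m+n _ _) (≤-reflexive (nCk+nC[k+1]≡[n+1]C[k+1] (a + j) a)))

[a+1]*[a+j]C[a+1]≡j*[a+j]Ca : ∀ a j → suc a * ((a + j) C suc a) ≡ j * ((a + j) C a)
[a+1]*[a+j]C[a+1]≡j*[a+j]Ca a j = +-cancelʳ-≡ _ _ _ (begin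
  suc a * L + suc a * c         ≡⟨ *-distribˡ-+ (suc a) L c ⟨
  suc a * (L + c)               ≡⟨ cong (suc a *_) (+-comm L c) ⟩
  suc a * (c + L)               ≡⟨ cong (suc a *_) (nCk+nC[k+1]≡[n+1]C[k+1] (a + j) a) ⟩
  suc a * (suc (a + j) C suc a) ≡⟨ [k+1]*[n+1]C[k+1]≡[n+1]*nCk (a + j) a ⟩
  suc (a + j) * c               ≡⟨ split c a j ⟩
  j * c + suc a * c ∎)
  where
  open ≡-Reasoning
  L = (a + j) C suc a
  c = (a + j) C a
  split : ∀ c a j → suc (a + j) * c ≡ j * c + suc a * c
  split = solve-∀

[j+1]*[a+j+1]Ca≡[a+j+1]*[a+j]Ca : ∀ a j → suc j * (suc (a + j) C a) ≡ suc (a + j) * ((a + j) C a)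
[j+1]*[a+j+1]Ca≡[a+j+1]*[a+j]Ca a j = begin
  suc j * (suc (a + j) C a)       ≡⟨ cong (λ m → suc j * (m C a)) (+-suc a j) ⟨
  suc j * ((a + suc j) C a)       ≡⟨ [a+1]*[a+j]C[a+1]≡j*[a+j]Ca a (suc j) ⟨
  suc a * ((a + suc j) C suc a)   ≡⟨ cong (λ m → suc a * (m C suc a)) (+-suc a j) ⟩
  suc a * (suc (a + j) C suc a)   ≡⟨ [k+1]*[n+1]C[k+1]≡[n+1]*nCk (a + j) a ⟩
  suc (a + j) * ((a + j) C a) ∎
  where open ≡-Reasoning

*-cross-≤ : ∀ {x y α β p q c} .{{_ : NonZero c}} →
            α * x ≡ p * c → β * y ≡ q * c → x ≤ y → β * p ≤ α * q
*-cross-≤ {x} {y} {α} {β} {p} {q} {c} αx≡pc βy≡qc x≤y = *-cancelʳ-≤ (β * p) (α * q) c (begin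
  β * p * c     ≡⟨ *-assoc β p c ⟩
  β * (p * c)   ≡⟨ cong (β *_) αx≡pc ⟨
  β * (α * x)   ≤⟨ *-monoʳ-≤ β (*-monoʳ-≤ α x≤y) ⟩
  β * (α * y)   ≡⟨ swap β α y ⟩
  α * (β * y)   ≡⟨ cong (α *_) βy≡qc ⟩
  α * (q * c)   ≡⟨ *-assoc α q c ⟨
  α * q * c ∎)
  where
  open ≤-Reasoning
  swap : ∀ β α y → β * (α * y) ≡ α * (β * y)
  swap = solve-∀

binomial-cross-≤ : ∀ a j → (a + j) C suc a ≤ suc (a + j) C a → suc j * j ≤ suc a * suc (a + j)
binomial-cross-≤ a j =
  *-cross-≤ {α = suc a} {suc j} {j} {suc (a + j)} {{>-nonZero (0<[a+j]Ca a j)}}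
    ([a+1]*[a+j]C[a+1]≡j*[a+j]Ca a j) ([j+1]*[a+j+1]Ca≡[a+j+1]*[a+j]Ca a j)

binomial-cross-≥ : ∀ a j → suc (a + j) C a ≤ (a + j) C suc a → suc a * suc (a + j) ≤ suc j * j
binomial-cross-≥ a j =
  *-cross-≤ {α = suc j} {suc a} {suc (a + j)} {j} {{>-nonZero (0<[a+j]Ca a j)}}
    ([j+1]*[a+j+1]Ca≡[a+j+1]*[a+j]Ca a j) ([a+1]*[a+j]C[a+1]≡j*[a+j]Ca a j)

maximiser-≤ : ∀ r m → IsMaximiser (r + m) r → r ≤ suc m
maximiser-≤ r m (_ , maximal) = ≮⇒≥ λ 1+m<r →
  contradiction (subst₂ _≤_ (cardQr-zero (r + m))
                            (trans (cardQr≡[1+m]Cr r m refl) (k>n⇒nCk≡0 1+m<r))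
                            (maximal 0 z≤n))
                λ ()

maximiser-upper : ∀ r k → IsMaximiser (r + (r + k)) r → suc k * k ≤ suc r * suc (r + k)
maximiser-upper r zero    _             = z≤n
maximiser-upper r (suc k) (_ , maximal) = binomial-cross-≤ r (suc k)
  (subst₂ _≤_ (cardQr[1+r]≡mC[1+r] r (r + suc k) refl) (cardQr≡[1+m]Cr r (r + suc k) refl)
              (maximal (suc r) (m<m+n r (≤-trans (s≤s z≤n) (m≤n+m (suc k) r)))))

maximiser-lower : ∀ a j → a + (a + j) ≡ n → IsMaximiser n (suc a) →
                  suc a * suc (a + j) ≤ suc j * j
maximiser-lower a j n≡ (_ , maximal) = binomial-cross-≥ a j
  (subst₂ _≤_ (cardQr≡[1+m]Cr a (a + j) n≡) (cardQr[1+r]≡mC[1+r] a (a + j) n≡)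
              (maximal a (≤-trans (m≤m+n a (a + j)) (≤-reflexive n≡))))

ceilLower ceilUpper : ℕ → ℕ → ℤ
ceilLower n r = + 5 ℤ.* + n ℤ.+ + 2 ℤ.- + 10 ℤ.* + r
ceilUpper n r = + 5 ℤ.* + n ℤ.+ + 12 ℤ.- + 10 ℤ.* + r

≤-by-margin : ∀ {x y p q : ℤ} → x ℤ.+ q ≡ y ℤ.+ p → p ℤ.≤ q → x ℤ.≤ y
≤-by-margin {x} {y} {p} {q} x+q≡y+p p≤q = begin
  x               ≡⟨ cancel x q ⟩
  x ℤ.+ q ℤ.- q   ≡⟨ cong (ℤ._- q) x+q≡y+p ⟩
  y ℤ.+ p ℤ.- q   ≤⟨ ℤₚ.+-monoˡ-≤ (ℤ.- q) (ℤₚ.+-monoʳ-≤ y p≤q) ⟩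
  y ℤ.+ q ℤ.- q   ≡⟨ cancel y q ⟨
  y ∎
  where
  open ℤₚ.≤-Reasoning
  cancel : ∀ x q → x ≡ x ℤ.+ q ℤ.- q
  cancel = ℤ-Solver.solve-∀

*-≤-toℤ : ∀ k l m n → k * l ≤ m * n → + k ℤ.* + l ℤ.≤ + m ℤ.* + n
*-≤-toℤ k l m n kl≤mn = subst₂ ℤ._≤_ (ℤₚ.pos-* k l) (ℤₚ.pos-* m n) (+≤+ kl≤mn)

0<[1+c]+5*x : ∀ c x → + 0 ℤ.< + suc c ℤ.+ + 5 ℤ.* + x
0<[1+c]+5*x c x = subst (λ y → + 0 ℤ.< + suc c ℤ.+ y) (ℤₚ.pos-* 5 x) (+<+ (s≤s z≤n))

square-ceilLower≤Dn : ∀ r k → suc k * k ≤ suc r * suc (r + k) →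
                      ceilLower (r + (r + k)) r ℤ.* ceilLower (r + (r + k)) r ℤ.≤ Dn (r + (r + k))
square-ceilLower≤Dn r k ineq =
  ≤-by-margin (identity (+ r) (+ k))
              (ℤₚ.*-monoˡ-≤-nonNeg (+ 20) (*-≤-toℤ (suc k) k (suc r) (suc (r + k)) ineq))
  where
  identity : ∀ R K → let N = R ℤ.+ (R ℤ.+ K)
                         A = + 5 ℤ.* N ℤ.+ + 2 ℤ.- + 10 ℤ.* R in
    A ℤ.* A ℤ.+ + 20 ℤ.* ((+ 1 ℤ.+ R) ℤ.* (+ 1 ℤ.+ (R ℤ.+ K)))
      ≡ + 5 ℤ.* N ℤ.* N ℤ.+ + 20 ℤ.* N ℤ.+ + 24 ℤ.+ + 20 ℤ.* ((+ 1 ℤ.+ K) ℤ.* K)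
  identity = ℤ-Solver.solve-∀

ceilLower≤0 : ∀ m d → ceilLower (suc m + d + m) (suc m + d) ℤ.≤ + 0
ceilLower≤0 m d = ≤-by-margin (identity (+ m) (+ d)) (ℤₚ.<⇒≤ (0<[1+c]+5*x 2 d))
  where
  identity : ∀ M D → let R = + 1 ℤ.+ M ℤ.+ D in
    + 5 ℤ.* (R ℤ.+ M) ℤ.+ + 2 ℤ.- + 10 ℤ.* R ℤ.+ (+ 3 ℤ.+ + 5 ℤ.* D) ≡ + 0 ℤ.+ + 0
  identity = ℤ-Solver.solve-∀

Dn≤square-ceilUpper : ∀ a j → a + (a + j) ≡ n → suc a * suc (a + j) ≤ suc j * j →
                      Dn n ℤ.≤ ceilUpper n (suc a) ℤ.* ceilUpper n (suc a)
Dn≤square-ceilUpper a j refl ineq =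
  ≤-by-margin (identity (+ a) (+ j))
              (ℤₚ.*-monoˡ-≤-nonNeg (+ 20) (*-≤-toℤ (suc a) (suc (a + j)) (suc j) j ineq))
  where
  identity : ∀ A J → let N = A ℤ.+ (A ℤ.+ J)
                         B = + 5 ℤ.* N ℤ.+ + 12 ℤ.- + 10 ℤ.* (+ 1 ℤ.+ A) in
    + 5 ℤ.* N ℤ.* N ℤ.+ + 20 ℤ.* N ℤ.+ + 24 ℤ.+ + 20 ℤ.* ((+ 1 ℤ.+ J) ℤ.* J)
      ≡ B ℤ.* B ℤ.+ + 20 ℤ.* ((+ 1 ℤ.+ A) ℤ.* (+ 1 ℤ.+ (A ℤ.+ J)))
  identity = ℤ-Solver.solve-∀

Dn≤square-ceilUpper-zero : ∀ n → Dn n ℤ.≤ ceilUpper n 0 ℤ.* ceilUpper n 0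
Dn≤square-ceilUpper-zero n =
  ≤-by-margin (identity (+ n)) (ℤₚ.*-monoˡ-≤-nonNeg (+ 20) (*-≤-toℤ 0 0 (n + 2) (n + 3) z≤n))
  where
  identity : ∀ N → let B = + 5 ℤ.* N ℤ.+ + 12 ℤ.- + 10 ℤ.* + 0 in
    + 5 ℤ.* N ℤ.* N ℤ.+ + 20 ℤ.* N ℤ.+ + 24 ℤ.+ + 20 ℤ.* ((N ℤ.+ + 2) ℤ.* (N ℤ.+ + 3))
      ≡ B ℤ.* B ℤ.+ + 0
  identity = ℤ-Solver.solve-∀

0<ceilUpper : ∀ a j → a + (a + j) ≡ n → + 0 ℤ.< ceilUpper n (suc a)
0<ceilUpper a j refl = subst (+ 0 ℤ.<_) (sym (identity (+ a) (+ j))) (0<[1+c]+5*x 1 j)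
  where
  identity : ∀ A J → + 5 ℤ.* (A ℤ.+ (A ℤ.+ J)) ℤ.+ + 12 ℤ.- + 10 ℤ.* (+ 1 ℤ.+ A)
                   ≡ + 2 ℤ.+ + 5 ℤ.* J
  identity = ℤ-Solver.solve-∀

0<ceilUpper-zero : ∀ n → + 0 ℤ.< ceilUpper n 0
0<ceilUpper-zero n = subst (+ 0 ℤ.<_) (sym (identity (+ n))) (0<[1+c]+5*x 11 n)
  where
  identity : ∀ N → + 5 ℤ.* N ℤ.+ + 12 ℤ.- + 10 ℤ.* + 0 ≡ + 12 ℤ.+ + 5 ℤ.* N
  identity = ℤ-Solver.solve-∀

ceilLower≤√Dn : ∀ {n r} → IsMaximiser n r → ceilLower n r ≤√ Dn n
ceilLower≤√Dn {r = r} max@(r≤n , _) with m≤n⇒∃[o]m+o≡n r≤n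
... | m , refl with r ≤? m
...   | yes r≤m with m≤n⇒∃[o]m+o≡n r≤m
...     | k , refl = inj₂ (square-ceilLower≤Dn r k (maximiser-upper r k max))
ceilLower≤√Dn _ | m , refl | no r≰m with m≤n⇒∃[o]m+o≡n (≰⇒> r≰m)
...     | d , refl = inj₁ (ceilLower≤0 m d)

ceilUpper-bound : ∀ {n r} → IsMaximiser n r →
                  + 0 ℤ.< ceilUpper n r × Dn n ℤ.≤ ceilUpper n r ℤ.* ceilUpper n r
ceilUpper-bound {n} {zero}  _             = 0<ceilUpper-zero n , Dn≤square-ceilUpper-zero n
ceilUpper-bound {r = suc a} max@(r≤n , _) with m≤n⇒∃[o]m+o≡n r≤n
... | m , refl with m≤n⇒∃[o]m+o≡n (s≤s⁻¹ (maximiser-≤ (suc a) m max))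
...   | i , refl =
  0<ceilUpper a (suc i) n≡ , Dn≤square-ceilUpper a (suc i) n≡ (maximiser-lower a (suc i) n≡ max)
  where
  n≡ : a + (a + suc i) ≡ suc a + (a + i)
  n≡ = trans (cong (λ m → a + m) (+-suc a i)) (+-suc a (a + i))

-- The argument also covers n = 0.
lemma3 : (n : ℕ) → 1 ≤ n → (r : ℕ) → IsMaximiser n r → IsCeilX n r ⊎ IsXPlusOne n r
lemma3 n _ r max with ceilUpper-bound max | Dn n ℤₚ.≟ ceilUpper n r ℤ.* ceilUpper n r
... | 0<B , _    | yes D≡B² = inj₂ (ℤₚ.<⇒≤ 0<B , sym D≡B²)
... | 0<B , D≤B² | no D≢B²  = inj₁ (ceilLower≤√Dn max , 0<B , ℤₚ.≤∧≢⇒< D≤B² D≢B²)
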